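{- Let $b\ge2$ and fix a positive integer $q$; write $q=uv$ where every prime dividing $u$ divides $b$ and $(v,b)=1$. Take $h\in\mathbb{Z}$ with $hb\equiv1\pmod v$. Suppose $d\mid bv$, $\ell\in(\mathbb{Z}/d\mathbb{Z})^*$ and $a\in\mathbb{Z}$ are such that $b^k(a/q+\ell/d)\in\mathbb{Z}$ for some $k\in\mathbb{N}$. Then: (i) $a\equiv-\big(\frac{bq}{d}\big)\ell h\pmod v$; (ii) there exists $L=L(q)$ depending only on $q$ such that $b^L(a/q+\ell/d)\in\mathbb{Z}$; indeed any positive integer $L$ with $u\mid b^L$ works. -}

module Defs where

open import Data.Integer using (ℤ)
open import Data.Rational using (ℚ; _/_)
open import Data.Product using (∃)
open import Relation.Binary.PropositionalEquality using (_≡_)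

IsInt : ℚ → Set
IsInt x = ∃ λ (z : ℤ) → x ≡ z / 1

-- Write N = a d + ℓ q, so that b^k (a/q + ℓ/d) = b^k N / (q d), and e = b v / d. Then b q / d = u e
-- and b N = d Y with Y = a b + u e ℓ. If b^k N / (q d) is an integer then q ∣ b^k Y, so v ∣ Y as v
-- is coprime to b; multiplying Y by h gives (i). Conversely, if v ∣ Y and b^L = w u with L > 0,
-- then b^L (a/q + ℓ/d) = (w a + b^(L-1) e ℓ) / v, and v divides that numerator because b times it
-- is w Y. Every prime factor of u divides b, so u divides b^L for L the number of prime factors
-- of u counted with multiplicity.

module Submission where

open import Defs
open import Data.Nat using (ℕ; _≥_; _>_; _^_; NonZero) renaming (_*_ to _*ℕ_)
open import Data.Nat.Divisibility using () renaming (_∣_ to _∣ℕ_)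
open import Data.Nat.DivMod using (_/_)
open import Data.Nat.Primality using (Prime)
open import Data.Nat.Coprimality using (Coprime)
open import Data.Integer using (ℤ; +_; ∣_∣; _*_; _-_; -_)
open import Data.Integer.Divisibility using (_∣_)
open import Data.Rational using () renaming (_/_ to _/ℚ_; _+_ to _+ℚ_; _*_ to _*ℚ_)
open import Data.Product using (_×_; ∃)

open import Data.Nat using (zero; suc; s≤s; z≤n; ≢-nonZero; ≢-nonZero⁻¹)
open import Data.Nat.Properties using (*-comm; *-assoc; *-identityˡ)
import Data.Nat.Divisibility as ℕ
import Data.Nat.Coprimality as ℕ
open import Data.Nat.DivMod using (m*n/n≡m)
open import Data.Nat.ListAction using (product)
open import Data.Nat.ListAction.Properties using (∈⇒∣product)
open import Data.Nat.Primality.Factorisation using (factorise; PrimeFactorisation)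
open import Data.Integer using (_+_; 1ℤ) renaming (NonZero to NonZeroℤ)
open import Data.Integer.Properties using (pos-*; abs-*; *-identityʳ) renaming (*-comm to *ℤ-comm)
open import Data.Integer.Coprimality using () renaming (Coprime to Coprimeℤ; coprime-divisor to coprime-divisorℤ)
open import Data.Integer.Divisibility.Signed as Signed
  using (divides; ∣ᵤ⇒∣; ∣⇒∣ᵤ; ∣-trans; ∣n⇒∣m*n; ∣m∣n⇒∣m-n; *-monoʳ-∣; *-monoˡ-∣; *-cancelˡ-∣)
open import Data.Integer.Tactic.RingSolver using (solve)
open import Data.Rational using (toℚᵘ)
open import Data.Rational.Properties using (toℚᵘ-fromℚᵘ; toℚᵘ-injective; toℚᵘ-cong; toℚᵘ-homo-+; toℚᵘ-homo-*)
open import Data.Rational.Unnormalised using (*≡*; _≃_) renaming (_/_ to _/ᵘ_; _+_ to _+ᵘ_; _*_ to _*ᵘ_)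
open import Data.Rational.Unnormalised.Properties
  using (≃-trans; ≃-sym; *-cong; *-congˡ; +-cong; module ≃-Reasoning)
open import Data.List using (List; length; _∷_; [])
open import Data.List.Relation.Unary.All as All using (All)
open import Data.Product using (_,_; proj₁; proj₂)
open import Function.Bundles using (_⇔_; mk⇔; Equivalence)
open import Relation.Binary.PropositionalEquality
  using (_≡_; sym; trans; cong; subst; subst₂; module ≡-Reasoning)

product-∣-^-length : ∀ {b} {ps : List ℕ} → All (_∣ℕ b) ps → product ps ∣ℕ b ^ length ps
product-∣-^-length All.[]           = ℕ.∣-refl
product-∣-^-length (p∣b All.∷ ps∣b) = ℕ.*-pres-∣ p∣b (product-∣-^-length ps∣b)

primeDivisors-∣⇒∣^ : ∀ {u} b .{{_ : NonZero u}} → (∀ p → Prime p → p ∣ℕ u → p ∣ℕ b) →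
                     ∃ λ k → u ∣ℕ b ^ k
primeDivisors-∣⇒∣^ {u} b prime∣u⇒∣b =
  length factors , subst (_∣ℕ b ^ length factors) (sym isFactorisation) (product-∣-^-length factors∣b)
  where
  open PrimeFactorisation (factorise u)
  factors∣b : All (_∣ℕ b) factors
  factors∣b = All.tabulate λ p∈ → prime∣u⇒∣b _ (All.lookup factorsPrime p∈)
    (subst (_ ∣ℕ_) (sym isFactorisation) (∈⇒∣product p∈))

coprime-divisor-^ : ∀ {m n o} → Coprime m n → ∀ k → m ∣ℕ n ^ k *ℕ o → m ∣ℕ o
coprime-divisor-^ {m} {o = o} m⊥n zero    m∣1*o = subst (m ∣ℕ_) (*-identityˡ o) m∣1*o
coprime-divisor-^ {m} {n} {o} m⊥n (suc k) m∣nᵏ⁺¹*o =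
  coprime-divisor-^ m⊥n k (ℕ.coprime-divisor m⊥n (subst (m ∣ℕ_) (*-assoc n (n ^ k) o) m∣nᵏ⁺¹*o))

[b*q]/d≡u*e : ∀ b u e d {q v} .{{_ : NonZero d}} → q ≡ u *ℕ v → b *ℕ v ≡ e *ℕ d → (b *ℕ q) / d ≡ u *ℕ e
[b*q]/d≡u*e b u e d {q} {v} q≡uv bv≡ed = trans (cong (_/ d) bq≡ued) (m*n/n≡m (u *ℕ e) d)
  where
  open ≡-Reasoning
  bq≡ued : b *ℕ q ≡ u *ℕ e *ℕ d
  bq≡ued = begin
    b *ℕ q            ≡⟨ cong (b *ℕ_) q≡uv ⟩
    b *ℕ (u *ℕ v)     ≡⟨ sym (*-assoc b u v) ⟩
    b *ℕ u *ℕ v       ≡⟨ cong (_*ℕ v) (*-comm b u) ⟩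
    u *ℕ b *ℕ v       ≡⟨ *-assoc u b v ⟩
    u *ℕ (b *ℕ v)     ≡⟨ cong (u *ℕ_) bv≡ed ⟩
    u *ℕ (e *ℕ d)     ≡⟨ sym (*-assoc u e d) ⟩
    u *ℕ e *ℕ d       ∎

pos-coprime-divisor-^ : ∀ {v b} k {x} → Coprime v b → + v Signed.∣ + (b ^ k) * x → + v Signed.∣ x
pos-coprime-divisor-^ {v} {b} k {x} v⊥b v∣bᵏx =
  ∣ᵤ⇒∣ (coprime-divisor-^ v⊥b k (subst (v ∣ℕ_) (abs-* (+ (b ^ k)) x) (∣⇒∣ᵤ v∣bᵏx)))

toℚᵘ-/ : ∀ n m .{{_ : NonZero m}} → toℚᵘ (n /ℚ m) ≃ n /ᵘ m
toℚᵘ-/ n (suc m) = toℚᵘ-fromℚᵘ (n /ᵘ suc m)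

IsInt⇔∣ : ∀ {p} n m .{{_ : NonZero m}} → toℚᵘ p ≃ n /ᵘ m → IsInt p ⇔ + m Signed.∣ n
IsInt⇔∣ {p} n (suc m) p≃n/m = mk⇔ to from
  where
  to : IsInt p → + suc m Signed.∣ n
  to (z , p≡z/1) with ≃-trans (≃-sym p≃n/m) (≃-trans (toℚᵘ-cong p≡z/1) (toℚᵘ-/ z 1))
  ... | *≡* n*1≡z*m = divides z (trans (sym (*-identityʳ n)) n*1≡z*m)
  from : + suc m Signed.∣ n → IsInt p
  from (divides z n≡z*m) = z , toℚᵘ-injective
    (≃-trans p≃n/m (≃-trans (*≡* (trans (*-identityʳ n) n≡z*m)) (≃-sym (toℚᵘ-/ z 1))))

IsInt-scaled-sum⇔ : ∀ r a ℓ q d .{{_ : NonZero q}} .{{_ : NonZero d}} →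
                    IsInt ((+ r /ℚ 1) *ℚ ((a /ℚ q) +ℚ (ℓ /ℚ d))) ⇔
                    (+ q * + d Signed.∣ + r * (a * + d + ℓ * + q))
IsInt-scaled-sum⇔ r a ℓ (suc q) (suc d) = IsInt⇔∣ _ (suc q *ℕ suc d) (begin
  toℚᵘ ((+ r /ℚ 1) *ℚ ((a /ℚ suc q) +ℚ (ℓ /ℚ suc d)))        ≈⟨ toℚᵘ-homo-* (+ r /ℚ 1) _ ⟩
  toℚᵘ (+ r /ℚ 1) *ᵘ toℚᵘ ((a /ℚ suc q) +ℚ (ℓ /ℚ suc d))     ≈⟨ *-cong (toℚᵘ-/ (+ r) 1) (toℚᵘ-homo-+ (a /ℚ suc q) _) ⟩
  (+ r /ᵘ 1) *ᵘ (toℚᵘ (a /ℚ suc q) +ᵘ toℚᵘ (ℓ /ℚ suc d))     ≈⟨ *-congˡ (+-cong (toℚᵘ-/ a (suc q)) (toℚᵘ-/ ℓ (suc d))) ⟩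
  -- the product's denominator is 1 * (q d), which is q d only propositionally
  (+ r /ᵘ 1) *ᵘ ((a /ᵘ suc q) +ᵘ (ℓ /ᵘ suc d))               ≈⟨ *≡* (cong (λ m → N * + m) (sym (*-identityˡ (suc q *ℕ suc d)))) ⟩
  N /ᵘ (suc q *ℕ suc d)                                      ∎)
  where
  open ≃-Reasoning
  N : ℤ
  N = + r * (a * + suc d + ℓ * + suc q)

∣ab+c⇒∣hb-1⇒∣a+ch : ∀ {v} a b c h → v Signed.∣ a * b + c → v Signed.∣ h * b - 1ℤ →
                    v Signed.∣ a - (- (c * h))
∣ab+c⇒∣hb-1⇒∣a+ch {v} a b c h v∣ab+c v∣hb-1 =
  subst (v Signed.∣_) identity (∣m∣n⇒∣m-n (∣n⇒∣m*n h v∣ab+c) (∣n⇒∣m*n a v∣hb-1))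
  where
  identity : h * (a * b + c) - a * (h * b - 1ℤ) ≡ a - (- (c * h))
  identity = solve (a ∷ b ∷ c ∷ h ∷ [])

module Numerators (b u v e d : ℤ) {q : ℤ} (q≡uv : q ≡ u * v) (bv≡ed : b * v ≡ e * d) (a ℓ : ℤ) where

  open ≡-Reasoning

  b*[ad+ℓq]≡d*[ab+ueℓ] : b * (a * d + ℓ * q) ≡ d * (a * b + u * e * ℓ)
  b*[ad+ℓq]≡d*[ab+ueℓ] = begin
    b * (a * d + ℓ * q)             ≡⟨ cong (λ x → b * (a * d + ℓ * x)) q≡uv ⟩
    b * (a * d + ℓ * (u * v))       ≡⟨ solve (a ∷ b ∷ d ∷ ℓ ∷ u ∷ v ∷ []) ⟩
    d * (a * b) + u * ℓ * (b * v)   ≡⟨ cong (λ x → d * (a * b) + u * ℓ * x) bv≡ed ⟩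
    d * (a * b) + u * ℓ * (e * d)   ≡⟨ solve (a ∷ b ∷ d ∷ ℓ ∷ u ∷ e ∷ []) ⟩
    d * (a * b + u * e * ℓ)         ∎

  q*d∣P*[ad+ℓq]⇒q∣P*[ab+ueℓ] : .{{_ : NonZeroℤ d}} → ∀ P →
    q * d Signed.∣ P * (a * d + ℓ * q) → q Signed.∣ P * (a * b + u * e * ℓ)
  q*d∣P*[ad+ℓq]⇒q∣P*[ab+ueℓ] P qd∣PN = *-cancelˡ-∣ d (subst₂ Signed._∣_ (*ℤ-comm q d) bPN≡dPY (∣n⇒∣m*n b qd∣PN))
    where
    bPN≡dPY : b * (P * (a * d + ℓ * q)) ≡ d * (P * (a * b + u * e * ℓ))
    bPN≡dPY = begin
      b * (P * (a * d + ℓ * q))          ≡⟨ solve (b ∷ P ∷ a ∷ d ∷ ℓ ∷ q ∷ []) ⟩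
      P * (b * (a * d + ℓ * q))          ≡⟨ cong (P *_) b*[ad+ℓq]≡d*[ab+ueℓ] ⟩
      P * (d * (a * b + u * e * ℓ))      ≡⟨ solve (P ∷ d ∷ a ∷ b ∷ u ∷ e ∷ ℓ ∷ []) ⟩
      d * (P * (a * b + u * e * ℓ))      ∎

  v∣ab+ueℓ⇒q*d∣bP*[ad+ℓq] : ∀ P w → Coprimeℤ v b → v Signed.∣ a * b + u * e * ℓ → b * P ≡ w * u →
    q * d Signed.∣ b * P * (a * d + ℓ * q)
  v∣ab+ueℓ⇒q*d∣bP*[ad+ℓq] P w v⊥b v∣Y bP≡wu =
    subst₂ Signed._∣_ (cong (_* d) (sym q≡uv)) (sym bPN≡uTd) (*-monoˡ-∣ d (*-monoʳ-∣ u v∣T))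
    where
    T : ℤ
    T = w * a + P * e * ℓ
    bT≡wY : b * T ≡ w * (a * b + u * e * ℓ)
    bT≡wY = begin
      b * (w * a + P * e * ℓ)             ≡⟨ solve (b ∷ w ∷ a ∷ P ∷ e ∷ ℓ ∷ []) ⟩
      w * (a * b) + (b * P) * e * ℓ       ≡⟨ cong (λ x → w * (a * b) + x * e * ℓ) bP≡wu ⟩
      w * (a * b) + (w * u) * e * ℓ       ≡⟨ solve (w ∷ a ∷ b ∷ u ∷ e ∷ ℓ ∷ []) ⟩
      w * (a * b + u * e * ℓ)             ∎
    v∣T : v Signed.∣ T
    v∣T = ∣ᵤ⇒∣ (coprime-divisorℤ v b T v⊥b (∣⇒∣ᵤ (subst (v Signed.∣_) (sym bT≡wY) (∣n⇒∣m*n w v∣Y))))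
    bPN≡uTd : b * P * (a * d + ℓ * q) ≡ u * T * d
    bPN≡uTd = begin
      b * P * (a * d + ℓ * q)                   ≡⟨ solve (b ∷ P ∷ a ∷ d ∷ ℓ ∷ q ∷ []) ⟩
      P * (b * (a * d + ℓ * q))                 ≡⟨ cong (P *_) b*[ad+ℓq]≡d*[ab+ueℓ] ⟩
      P * (d * (a * b + u * e * ℓ))             ≡⟨ solve (P ∷ d ∷ a ∷ b ∷ u ∷ e ∷ ℓ ∷ []) ⟩
      (a * (b * P) + u * (P * e * ℓ)) * d       ≡⟨ cong (λ x → (a * x + u * (P * e * ℓ)) * d) bP≡wu ⟩
      (a * (w * u) + u * (P * e * ℓ)) * d       ≡⟨ solve (a ∷ w ∷ u ∷ P ∷ e ∷ ℓ ∷ d ∷ []) ⟩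
      u * (w * a + P * e * ℓ) * d               ∎

lemma5p2 : (b q u v : ℕ) → b ≥ 2 → .{{_ : NonZero q}} → q ≡ u *ℕ v
    → (∀ p → Prime p → p ∣ℕ u → p ∣ℕ b) → Coprime v b
    → (h : ℤ) → (+ v) ∣ (h * + b - + 1)
    → (d : ℕ) → .{{_ : NonZero d}} → d ∣ℕ (b *ℕ v)
    → (ℓ : ℤ) → Coprime ∣ ℓ ∣ d
    → (a : ℤ)
    → ∃ (λ (k : ℕ) → IsInt ((+ (b ^ k) /ℚ 1) *ℚ ((a /ℚ q) +ℚ (ℓ /ℚ d))))
    → ((+ v) ∣ (a - (- (+ ((b *ℕ q) / d) * ℓ * h))))
    × (∃ (λ (L : ℕ) → L > 0 × u ∣ℕ (b ^ L) × IsInt ((+ (b ^ L) /ℚ 1) *ℚ ((a /ℚ q) +ℚ (ℓ /ℚ d)))))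
    × (∀ (L : ℕ) → L > 0 → u ∣ℕ (b ^ L) → IsInt ((+ (b ^ L) /ℚ 1) *ℚ ((a /ℚ q) +ℚ (ℓ /ℚ d))))
lemma5p2 b q u v _ q≡uv prime∣u⇒∣b v⊥b h v∣hb-1 d (ℕ.divides e bv≡ed) ℓ _ a (k , bᵏx∈ℤ) =
  ∣⇒∣ᵤ congruence , (suc L , s≤s z≤n , u∣bᴸ⁺¹ , integral (suc L) (s≤s z≤n) u∣bᴸ⁺¹) , integral
  where
  open Equivalence
  +q≡+u*+v : + q ≡ + u * + v
  +q≡+u*+v = trans (cong +_ q≡uv) (pos-* u v)
  open Numerators (+ b) (+ u) (+ v) (+ e) (+ d) +q≡+u*+v
                  (trans (sym (pos-* b v)) (trans (cong +_ bv≡ed) (pos-* e d))) a ℓ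

  v∣ab+ueℓ : + v Signed.∣ a * + b + + u * + e * ℓ
  v∣ab+ueℓ = pos-coprime-divisor-^ k v⊥b (∣-trans (divides (+ u) +q≡+u*+v)
    (q*d∣P*[ad+ℓq]⇒q∣P*[ab+ueℓ] (+ (b ^ k)) (to (IsInt-scaled-sum⇔ (b ^ k) a ℓ q d) bᵏx∈ℤ)))

  congruence : + v Signed.∣ a - (- (+ ((b *ℕ q) / d) * ℓ * h))
  congruence = subst (λ E → + v Signed.∣ a - (- (E * ℓ * h)))
    (trans (sym (pos-* u e)) (cong +_ (sym ([b*q]/d≡u*e b u e d q≡uv bv≡ed))))
    (∣ab+c⇒∣hb-1⇒∣a+ch a (+ b) (+ u * + e * ℓ) h v∣ab+ueℓ (∣ᵤ⇒∣ v∣hb-1))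

  integral : ∀ L → L > 0 → u ∣ℕ b ^ L → IsInt ((+ (b ^ L) /ℚ 1) *ℚ ((a /ℚ q) +ℚ (ℓ /ℚ d)))
  integral (suc L) _ (ℕ.divides w bᴸ⁺¹≡wu) = from (IsInt-scaled-sum⇔ (b ^ suc L) a ℓ q d)
    (subst (λ x → + q * + d Signed.∣ x * (a * + d + ℓ * + q)) (sym (pos-* b (b ^ L)))
      (v∣ab+ueℓ⇒q*d∣bP*[ad+ℓq] (+ (b ^ L)) (+ w) v⊥b v∣ab+ueℓ
        (trans (sym (pos-* b (b ^ L))) (trans (cong +_ bᴸ⁺¹≡wu) (pos-* w u)))))

  instance
    u≢0 : NonZero u
    u≢0 = ≢-nonZero λ u≡0 → ≢-nonZero⁻¹ q (trans q≡uv (cong (_*ℕ v) u≡0))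
  L : ℕ
  L = proj₁ (primeDivisors-∣⇒∣^ b prime∣u⇒∣b)
  u∣bᴸ⁺¹ : u ∣ℕ b ^ suc L
  u∣bᴸ⁺¹ = ℕ.∣-trans (proj₂ (primeDivisors-∣⇒∣^ b prime∣u⇒∣b)) (ℕ.n∣m*n b)
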